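{- For any directed tree $T$ of order $n\ge2$, $L^t_2(T)\le\gamma^t_{\times2}(T)$.
   Context: A directed tree is a digraph whose underlying graph is a tree. A vertex $u$ is adjacent with $v$ if $(u,v)$ or $(v,u)$ is an arc; $D\langle S\rangle$ is the subdigraph induced by $S$. A total $2$-dominating set is a set $S\subseteq V(T)$ such that $T\langle S\rangle$ has no isolated vertices and every vertex of $V(T)\setminus S$ has at least two in-neighbours in $S$; $\gamma^t_{\times2}(T)$ is its minimum size. A total $2$-limited packing is a set $B\subseteq V(T)$ such that every vertex in $B$ is adjacent with at most one vertex of $B$ and every vertex in $V(T)\setminus B$ has at most two out-neighbours in $B$; $L^t_2(T)$ is its maximum size. -}

module Defs where

open import Data.Nat using (ℕ; _≤_; suc)
open import Data.Bool using (Bool; T)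
open import Data.Fin using (Fin)
open import Data.Fin.Subset using (Subset; _∈_; _∉_)
open import Data.Fin.Subset.Properties using (_∈?_)
open import Data.List using (List; []; _∷_; length; filter; last)
open import Data.List.Relation.Unary.Unique.Propositional using (Unique)
open import Data.List.Relation.Unary.Linked using (Linked)
open import Data.Product using (∃; _×_; Σ)
open import Data.Sum using (_⊎_)
open import Data.Maybe using (just)
open import Relation.Binary.PropositionalEquality using (_≡_)
open import Relation.Nullary using (¬_)
open import Relation.Nullary.Decidable using (_×-dec_; _⊎-dec_)
open import Data.Bool.Properties using (T?)
open import Data.List using (allFin)

Digraph : ℕ → Set
Digraph n = Fin n → Fin n → Bool

module _ {n : ℕ} (D : Digraph n) where

  Arc : Fin n → Fin n → Set
  Arc u v = T (D u v)

  Adj : Fin n → Fin n → Set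
  Adj u v = Arc u v ⊎ Arc v u

  data Walk : Fin n → Fin n → Set where
    here : ∀ {u} → Walk u u
    step : ∀ {u v w} → Adj u v → Walk v w → Walk u w

  Connected : Set
  Connected = ∀ u v → Walk u v

  IsCycle : List (Fin n) → Set
  IsCycle [] = ⊥'
    where open import Data.Empty using () renaming (⊥ to ⊥')
  IsCycle (v ∷ vs) =
    (2 ≤ length vs) × Unique (v ∷ vs) × Linked Adj (v ∷ vs)
      × (∀ w → last (v ∷ vs) ≡ just w → Adj w v)

  Acyclic : Set
  Acyclic = ∀ cs → ¬ IsCycle cs

  -- the underlying graph is a (simple) tree: no loops, no pair of opposite
  -- arcs (which would form a multiple edge), connected and acyclic
  IsDirectedTree : Set
  IsDirectedTree =
    (∀ u → ¬ Arc u u) × (∀ u v → Arc u v → ¬ Arc v u) × Connected × Acyclic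

  inDegIn : Subset n → Fin n → ℕ
  inDegIn S v = length (filter (λ u → (u ∈? S) ×-dec T? (D u v)) (allFin n))

  outDegIn : Subset n → Fin n → ℕ
  outDegIn S v = length (filter (λ u → (u ∈? S) ×-dec T? (D v u)) (allFin n))

  adjIn : Subset n → Fin n → ℕ
  adjIn S v =
    length (filter (λ u → (u ∈? S) ×-dec (T? (D u v) ⊎-dec T? (D v u))) (allFin n))

  IsTotal2Dominating : Subset n → Set
  IsTotal2Dominating S =
    (∀ v → v ∈ S → Σ (Fin n) λ u → u ∈ S × Adj u v)
    × (∀ v → v ∉ S → 2 ≤ inDegIn S v)

  IsTotal2LimitedPacking : Subset n → Set
  IsTotal2LimitedPacking B =
    (∀ v → v ∈ B → adjIn B v ≤ 1)
    × (∀ v → v ∉ B → outDegIn B v ≤ 2)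

-- Let every vertex of B ∖ S charge each of its in-neighbours in S, and every vertex of
-- B ∩ S charge each of its neighbours in S ∖ B. Charges run along edges of T and never
-- both ways along one edge, so they orient a subforest of T whose vertices, the involved
-- ones, number at least as many as its edges. A vertex of B ∖ S has two in-neighbours in S,
-- so it makes at least two charges. An in-neighbour a ∈ B ∩ S of such a vertex has a
-- neighbour in S (total domination) which cannot lie in B (a already has a neighbour in B),
-- so a charges it; hence the involved vertices are those of B ∖ S, of S ∖ B and the
-- charging vertices of B ∩ S, whose number we call r. Counting charges then gives
-- 2|B ∖ S| + r ≤ |B ∖ S| + |S ∖ B| + r, i.e. |B ∖ S| ≤ |S ∖ B|, and so |B| ≤ |S|.
--
-- A forest has at most as many edges as vertices: a maximal path ends in a vertex with at
-- most one neighbour, since any other neighbour on the path would close a cycle; remove it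
-- and induct.

module Submission where

open import Defs
open import Data.Nat using (ℕ; zero; suc; _+_; _*_; _≤_; _<_; z≤n; s≤s)
open import Data.Nat.Properties
  using ( +-*-semiring; ≤-refl; ≤-reflexive; ≤-trans; ≤-pred; n≮0; <-irrefl; +-identityʳ; +-assoc
        ; +-comm; +-mono-≤; +-monoˡ-≤; +-mono-<-≤; +-mono-≤-<; +-cancelˡ-≤; +-cancelʳ-≤; module ≤-Reasoning)
open import Data.Bool using (if_then_else_)
open import Data.Fin using (Fin; zero; suc)
open import Data.Fin.Properties using (_≟_; any?)
open import Data.Fin.Subset using (Subset; ∣_∣; inside; outside)
open import Data.Fin.Subset.Properties using (_∈?_)
open import Data.List using (List; []; _∷_; length; filter; tabulate; allFin)
open import Data.Vec using ([]; _∷_)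
open import Data.Product using (_×_; _,_; proj₁; proj₂; ∃; ∃₂; swap)
open import Data.Empty using (⊥-elim)
open import Data.Sum using (_⊎_; inj₁; inj₂) renaming (swap to ⊎-swap)
open import Function using (_∘_)
open import Level using (0ℓ)
open import Relation.Nullary using (Dec; yes; no; does; ¬_; ¬?)
open import Relation.Nullary.Decidable using (_×-dec_; _⊎-dec_; decidable-stable)
open import Relation.Binary using (Rel) renaming (Decidable to Decidable₂)
open import Relation.Unary using (Pred; Decidable; _⊆_; _∩_; ∁; Empty)
open import Relation.Unary.Properties using (_∩?_; _∪?_; ∁?; ∅?)
open import Relation.Binary.PropositionalEquality using (_≡_; _≢_; refl; cong; cong₂; sym; trans; subst)
open import Algebra.Properties.Semiring.Sum +-*-semiring
  using (sum; ∑-distrib-+; sum-cong-≗; sum-replicate-zero; *-distribˡ-sum)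

⟦_⟧ : {P : Set} → Dec P → ℕ
⟦ d ⟧ = if does d then 1 else 0

⟦⟧-mono : {P Q : Set} (P? : Dec P) (Q? : Dec Q) → (P → Q) → ⟦ P? ⟧ ≤ ⟦ Q? ⟧
⟦⟧-mono (no _)  _        _   = z≤n
⟦⟧-mono (yes _) (yes _)  _   = ≤-refl
⟦⟧-mono (yes p) (no ¬q)  p→q = ⊥-elim (¬q (p→q p))

count : ∀ {n} {P : Pred (Fin n) 0ℓ} → Decidable P → ℕ
count P? = sum (λ i → ⟦ P? i ⟧)

sum-mono-≤ : ∀ {n} {f g : Fin n → ℕ} → (∀ i → f i ≤ g i) → sum f ≤ sum g
sum-mono-≤ {zero}  f≤g = z≤n
sum-mono-≤ {suc n} f≤g = +-mono-≤ (f≤g zero) (sum-mono-≤ (f≤g ∘ suc))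

sum-mono-< : ∀ {n} {f g : Fin n → ℕ} → (∀ i → f i ≤ g i) → ∀ j → f j < g j → sum f < sum g
sum-mono-< f≤g zero    fj<gj = +-mono-<-≤ fj<gj (sum-mono-≤ (f≤g ∘ suc))
sum-mono-< f≤g (suc j) fj<gj = +-mono-≤-< (f≤g zero) (sum-mono-< (f≤g ∘ suc) j fj<gj)

sum-δ : ∀ {n} (x : Fin n) (f : Fin n → ℕ) → sum (λ i → ⟦ i ≟ x ⟧ * f i) ≡ f x
sum-δ {suc n} zero f = trans (cong (f zero + 0 +_) (sum-replicate-zero n))
  (trans (+-identityʳ _) (+-identityʳ _))
sum-δ {suc n} (suc x) f = sum-δ x (f ∘ suc)

count-empty : ∀ {n} {P : Pred (Fin n) 0ℓ} (P? : Decidable P) → Empty P → count P? ≡ 0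
count-empty {n} P? ∄P = trans (sum-cong-≗ pointwise) (sum-replicate-zero n)
  where
  pointwise : ∀ i → ⟦ P? i ⟧ ≡ 0
  pointwise i with P? i
  ... | yes Pi = ⊥-elim (∄P i Pi)
  ... | no _   = refl

module _ {n : ℕ} {P Q : Pred (Fin n) 0ℓ} (P? : Decidable P) (Q? : Decidable Q) where

  count-mono : P ⊆ Q → count P? ≤ count Q?
  count-mono P⊆Q = sum-mono-≤ (λ i → ⟦⟧-mono (P? i) (Q? i) P⊆Q)

  count-mono-< : P ⊆ Q → ∀ {j} → Q j → ¬ P j → count P? < count Q?
  count-mono-< P⊆Q {j} Qj ¬Pj = sum-mono-< (λ i → ⟦⟧-mono (P? i) (Q? i) P⊆Q) j strict
    where
    strict : ⟦ P? j ⟧ < ⟦ Q? j ⟧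
    strict with P? j | Q? j
    ... | yes Pj | _      = ⊥-elim (¬Pj Pj)
    ... | no _   | yes _  = s≤s z≤n
    ... | no _   | no ¬Qj = ⊥-elim (¬Qj Qj)

  count-∪ : count (P? ∪? Q?) ≤ count P? + count Q?
  count-∪ = ≤-trans (sum-mono-≤ pointwise) (≤-reflexive (∑-distrib-+ (⟦_⟧ ∘ P?) (⟦_⟧ ∘ Q?)))
    where
    pointwise : ∀ i → ⟦ (P? ∪? Q?) i ⟧ ≤ ⟦ P? i ⟧ + ⟦ Q? i ⟧
    pointwise i with P? i | Q? i
    ... | yes _ | _     = s≤s z≤n
    ... | no _  | yes _ = s≤s z≤n
    ... | no _  | no _  = z≤n

  count-split : count P? ≡ count (P? ∩? Q?) + count (P? ∩? ∁? Q?)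
  count-split = trans (sum-cong-≗ pointwise) (∑-distrib-+ (⟦_⟧ ∘ (P? ∩? Q?)) (⟦_⟧ ∘ (P? ∩? ∁? Q?)))
    where
    pointwise : ∀ i → ⟦ P? i ⟧ ≡ ⟦ (P? ∩? Q?) i ⟧ + ⟦ (P? ∩? ∁? Q?) i ⟧
    pointwise i with P? i | Q? i
    ... | yes _ | yes _ = refl
    ... | yes _ | no _  = refl
    ... | no _  | _     = refl

count>0 : ∀ {n} {P : Pred (Fin n) 0ℓ} (P? : Decidable P) {i} → P i → 0 < count P?
count>0 {n} P? Pi = subst (_< count P?) (count-empty (∅? {A = Fin n}) λ _ ()) (count-mono-< ∅? P? (λ ()) Pi (λ ()))

count≥2 : ∀ {n} {P : Pred (Fin n) 0ℓ} (P? : Decidable P) {i j} → P i → P j → i ≢ j → 2 ≤ count P?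
count≥2 P? {i} {j} Pi Pj i≢j =
  ≤-trans (s≤s (count>0 (P? ∩? ∁? (_≟ j)) (Pi , i≢j)))
    (count-mono-< (P? ∩? ∁? (_≟ j)) P? proj₁ Pj (λ (_ , j≢j) → j≢j refl))

length-filter-tabulate : ∀ {A : Set} {P : Pred A 0ℓ} (P? : Decidable P) {n} (f : Fin n → A) →
  length (filter P? (tabulate f)) ≡ sum (λ i → ⟦ P? (f i) ⟧)
length-filter-tabulate P? {zero}  f = refl
length-filter-tabulate P? {suc n} f with P? (f zero)
... | yes _ = cong suc (length-filter-tabulate P? (f ∘ suc))
... | no _  = length-filter-tabulate P? (f ∘ suc)

length-filter-allFin : ∀ {n} {P : Pred (Fin n) 0ℓ} (P? : Decidable P) → length (filter P? (allFin n)) ≡ count P?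
length-filter-allFin P? = length-filter-tabulate P? (λ i → i)

∣p∣≡count-∈ : ∀ {n} (p : Subset n) → ∣ p ∣ ≡ count (_∈? p)
∣p∣≡count-∈ []            = refl
∣p∣≡count-∈ (inside ∷ p)  = cong suc (∣p∣≡count-∈ p)
∣p∣≡count-∈ (outside ∷ p) = ∣p∣≡count-∈ p

module Prefix {A : Set} where

  open import Data.List.Membership.Propositional using (_∈_)
  open import Data.List.Relation.Unary.Any using (here; there)
  open import Data.List.Relation.Unary.All using (All; []; _∷_)
  open import Data.List.Relation.Unary.AllPairs using (AllPairs; []; _∷_)
  open import Data.List.Relation.Unary.Linked using (Linked; [-]; _∷_)
  open import Data.Maybe using (just)
  open import Data.List using (last)

  takeTo : ∀ {z} (xs : List A) → z ∈ xs → List A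
  takeTo (w ∷ _)  (here _)  = w ∷ []
  takeTo (w ∷ xs) (there p) = w ∷ takeTo xs p

  takeTo-All : ∀ {P : Pred A 0ℓ} {z xs} (p : z ∈ xs) → All P xs → All P (takeTo xs p)
  takeTo-All (here _)  (Pw ∷ _)   = Pw ∷ []
  takeTo-All (there p) (Pw ∷ Pxs) = Pw ∷ takeTo-All p Pxs

  takeTo-AllPairs : ∀ {R : Rel A 0ℓ} {z xs} (p : z ∈ xs) → AllPairs R xs → AllPairs R (takeTo xs p)
  takeTo-AllPairs (here _)  (_ ∷ _)       = [] ∷ []
  takeTo-AllPairs (there p) (Rw ∷ Rxs)    = takeTo-All p Rw ∷ takeTo-AllPairs p Rxs

  takeTo-Linked : ∀ {R : Rel A 0ℓ} {x z xs} (p : z ∈ xs) → Linked R (x ∷ xs) → Linked R (x ∷ takeTo xs p)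
  takeTo-Linked (here _)  (Rxw ∷ _)   = Rxw ∷ [-]
  takeTo-Linked (there p) (Rxw ∷ Rxs) = Rxw ∷ takeTo-Linked p Rxs

  last-takeTo : ∀ {z xs} (p : z ∈ xs) (w : A) → last (w ∷ takeTo xs p) ≡ just z
  last-takeTo (here refl)           w = refl
  last-takeTo {xs = v ∷ _} (there p) w = last-takeTo p v

  0<length-takeTo : ∀ {z xs} (p : z ∈ xs) → 0 < length (takeTo xs p)
  0<length-takeTo (here _)  = s≤s z≤n
  0<length-takeTo (there _) = s≤s z≤n

⟦⟧-union-bound : {A B C : Set} (a : Dec A) (b : Dec B) (c : Dec C) →
  ⟦ a ⟧ ≤ ⟦ a ×-dec ¬? b ×-dec ¬? c ⟧ + ⟦ b ⟧ * ⟦ a ⟧ + ⟦ c ⟧ * ⟦ a ⟧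
⟦⟧-union-bound (no _)  _       _       = z≤n
⟦⟧-union-bound (yes _) (yes _) _       = s≤s z≤n
⟦⟧-union-bound (yes _) (no _)  (yes _) = s≤s z≤n
⟦⟧-union-bound (yes _) (no _)  (no _)  = s≤s z≤n

⟦⟧+⟦⟧+⟦⟧≤ : {P Q : Set} (P? : Dec P) (Q? : Dec Q) {k : ℕ} → (P → ¬ Q) → (P → 2 ≤ k) → (Q → 1 ≤ k) →
  ⟦ P? ⟧ + ⟦ P? ⟧ + ⟦ Q? ⟧ ≤ k
⟦⟧+⟦⟧+⟦⟧≤ (yes p) (yes q) p→¬q _   _   = ⊥-elim (p→¬q p q)
⟦⟧+⟦⟧+⟦⟧≤ (yes p) (no _)  _    2≤k _   = 2≤k p
⟦⟧+⟦⟧+⟦⟧≤ (no _)  (yes q) _    _   1≤k = 1≤k q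
⟦⟧+⟦⟧+⟦⟧≤ (no _)  (no _)  _    _   _   = z≤n

sum-distrib₃ : ∀ {n} (f g h : Fin n → ℕ) → sum (λ i → f i + g i + h i) ≡ sum f + sum g + sum h
sum-distrib₃ f g h =
  trans (∑-distrib-+ (λ i → f i + g i) h) (cong (_+ sum h) (∑-distrib-+ f g))

module Forest {n : ℕ} (D : Digraph n) (loopless : ∀ u → ¬ Arc D u u) (acyclic : Acyclic D) where

  open import Data.List.Membership.Propositional using (_∈_)
  open import Data.List.Membership.DecPropositional (_≟_ {n}) using () renaming (_∈?_ to _∈ₗ?_)
  open import Data.List.Relation.Unary.Any using (here; there)
  open import Data.List.Relation.Unary.All using ([]; _∷_)
  open import Data.List.Relation.Unary.All.Properties using (¬Any⇒All¬)
  open import Data.List.Relation.Unary.AllPairs using ([]; _∷_)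
  open import Data.List.Relation.Unary.Linked using (Linked; [-]; _∷_)
  open import Data.List.Relation.Unary.Unique.Propositional using (Unique)
  open import Data.Maybe.Properties using (just-injective)
  open Prefix

  Adj-irrefl : ∀ u → ¬ Adj D u u
  Adj-irrefl u (inj₁ uu) = loopless u uu
  Adj-irrefl u (inj₂ uu) = loopless u uu

  no-chord : ∀ {x y z rest} → Unique (x ∷ y ∷ rest) → Linked (Adj D) (x ∷ y ∷ rest) →
    z ∈ rest → ¬ Adj D z x
  no-chord {x} {y} {z} {rest} uniq path z∈rest zx =
    acyclic (takeTo (x ∷ y ∷ rest) z∈xyrest)
      ( s≤s (0<length-takeTo z∈rest)
      , takeTo-AllPairs z∈xyrest uniq
      , takeTo-Linked z∈yrest path
      , λ w last≡w → subst (λ v → Adj D v x) (just-injective (trans (sym (last-takeTo z∈yrest x)) last≡w)) zx )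
    where
    z∈yrest : z ∈ y ∷ rest
    z∈yrest = there z∈rest
    z∈xyrest : z ∈ x ∷ y ∷ rest
    z∈xyrest = there z∈yrest

  record Orientation (V : Pred (Fin n) 0ℓ) (E : Rel (Fin n) 0ℓ) : Set where
    field
      adjacent   : ∀ {u v} → E u v → Adj D u v
      asymmetric : ∀ {u v} → E u v → ¬ E v u
      endpoints  : ∀ {u v} → E u v → V u × V v

  open Orientation

  Neighbour : Rel (Fin n) 0ℓ → Rel (Fin n) 0ℓ
  Neighbour E x a = E x a ⊎ E a x

  module _ {V : Pred (Fin n) 0ℓ} {E : Rel (Fin n) 0ℓ} (E? : Decidable₂ E) (o : Orientation V E) where

    private
      neighbour? : Decidable₂ (Neighbour E)
      neighbour? x a = E? x a ⊎-dec E? a x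

      neighbour-adj : ∀ {x a} → Neighbour E x a → Adj D a x
      neighbour-adj (inj₁ xa) = ⊎-swap (adjacent o xa)
      neighbour-adj (inj₂ ax) = adjacent o ax

      neighbour-∈ : ∀ {x a} → Neighbour E x a → V a
      neighbour-∈ (inj₁ xa) = proj₂ (endpoints o xa)
      neighbour-∈ (inj₂ ax) = proj₁ (endpoints o ax)

      MaximalPath : Set
      MaximalPath = ∃₂ λ x rest → V x × Unique (x ∷ rest) × Linked (Adj D) (x ∷ rest)
        × Neighbour E x ⊆ (_∈ x ∷ rest)

      unvisited : List (Fin n) → ℕ
      unvisited path = count (∁? (_∈ₗ? path))

      extend : ∀ k x rest → unvisited (x ∷ rest) ≤ k →
        V x → Unique (x ∷ rest) → Linked (Adj D) (x ∷ rest) → MaximalPath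
      extend k x rest fuel Vx uniq path with any? (λ a → neighbour? x a ×-dec ¬? (a ∈ₗ? (x ∷ rest)))
      ... | no ∄a = x , rest , Vx , uniq , path ,
            λ {a} xa → decidable-stable (a ∈ₗ? (x ∷ rest)) (λ a∉ → ∄a (a , xa , a∉))
      extend zero    x rest fuel Vx uniq path | yes (a , xa , a∉) =
        ⊥-elim (n≮0 (≤-trans (count>0 (∁? (_∈ₗ? (x ∷ rest))) a∉) fuel))
      extend (suc k) x rest fuel Vx uniq path | yes (a , xa , a∉) =
        extend k a (x ∷ rest) (≤-pred (≤-trans shrinks fuel))
          (neighbour-∈ xa) (¬Any⇒All¬ _ a∉ ∷ uniq) (neighbour-adj xa ∷ path)
        where
        shrinks : unvisited (a ∷ x ∷ rest) < unvisited (x ∷ rest)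
        shrinks = count-mono-< (∁? (_∈ₗ? (a ∷ x ∷ rest))) (∁? (_∈ₗ? (x ∷ rest)))
          (λ i∉ i∈ → i∉ (there i∈)) a∉ (λ a∉' → a∉' (here refl))

      isolated : ∀ {x a} → Neighbour E x a → ¬ a ∈ x ∷ []
      isolated xa (here refl) = Adj-irrefl _ (neighbour-adj xa)

      only-neighbour : ∀ {x y rest a} → Unique (x ∷ y ∷ rest) → Linked (Adj D) (x ∷ y ∷ rest) →
        Neighbour E x a → a ∈ x ∷ y ∷ rest → a ≡ y
      only-neighbour _    _    xa (here refl)             = ⊥-elim (isolated xa (here refl))
      only-neighbour _    _    _  (there (here a≡y))      = a≡y
      only-neighbour uniq path xa (there (there a∈rest)) = ⊥-elim (no-chord uniq path a∈rest (neighbour-adj xa))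

      end-is-leaf : MaximalPath → ∃ λ x → V x × ∃ λ y → Neighbour E x ⊆ (_≡ y)
      end-is-leaf (x , [] , Vx , _ , _ , nbrs) =
        x , Vx , x , λ xa → ⊥-elim (isolated xa (nbrs xa))
      end-is-leaf (x , y ∷ rest , Vx , uniq , path , nbrs) =
        x , Vx , y , λ xa → only-neighbour uniq path xa (nbrs xa)

    leaf : ∀ {x₀} → V x₀ → ∃ λ x → V x × ∃ λ y → Neighbour E x ⊆ (_≡ y)
    leaf Vx₀ = end-is-leaf (extend _ _ [] ≤-refl Vx₀ ([] ∷ []) [-])

  edges : {E : Rel (Fin n) 0ℓ} → Decidable₂ E → ℕ
  edges E? = sum (λ u → count (E? u))

  degree : {E : Rel (Fin n) 0ℓ} → Decidable₂ E → Fin n → ℕ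
  degree E? x = sum (λ a → ⟦ E? x a ⟧ + ⟦ E? a x ⟧)

  degree≤1 : ∀ {E : Rel (Fin n) 0ℓ} (E? : Decidable₂ E) → (∀ {u v} → E u v → ¬ E v u) →
    ∀ {x y} → Neighbour E x ⊆ (_≡ y) → degree E? x ≤ 1
  degree≤1 E? asym {x} {y} nbrs = ≤-trans (sum-mono-≤ pointwise) (≤-reflexive (sum-δ y (λ _ → 1)))
    where
    pointwise : ∀ a → ⟦ E? x a ⟧ + ⟦ E? a x ⟧ ≤ ⟦ a ≟ y ⟧ * 1
    pointwise a with a ≟ y | E? x a | E? a x
    ... | _       | no _   | no _    = z≤n
    ... | yes _   | yes xa | yes ax  = ⊥-elim (asym xa ax)
    ... | yes _   | yes _  | no _    = ≤-refl
    ... | yes _   | no _   | yes _   = ≤-refl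
    ... | no a≢y  | yes xa | _       = ⊥-elim (a≢y (nbrs (inj₁ xa)))
    ... | no a≢y  | no _   | yes ax  = ⊥-elim (a≢y (nbrs (inj₂ ax)))

  Avoiding : Rel (Fin n) 0ℓ → Fin n → Rel (Fin n) 0ℓ
  Avoiding E x u v = E u v × u ≢ x × v ≢ x

  avoiding? : ∀ {E} → Decidable₂ E → ∀ x → Decidable₂ (Avoiding E x)
  avoiding? E? x u v = E? u v ×-dec ¬? (u ≟ x) ×-dec ¬? (v ≟ x)

  edges≤edges-avoiding+degree : ∀ {E} (E? : Decidable₂ E) x →
    edges E? ≤ edges (avoiding? E? x) + degree E? x
  edges≤edges-avoiding+degree E? x = begin
    edges E?
      ≤⟨ sum-mono-≤ (λ u → sum-mono-≤ (λ v → ⟦⟧-union-bound (E? u v) (u ≟ x) (v ≟ x))) ⟩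
    sum (λ u → sum (λ v → ⟦ avoiding? E? x u v ⟧ + ⟦ u ≟ x ⟧ * ⟦ E? u v ⟧ + ⟦ v ≟ x ⟧ * ⟦ E? u v ⟧))
      ≡⟨ sum-cong-≗ row ⟩
    sum (λ u → count (avoiding? E? x u) + ⟦ u ≟ x ⟧ * count (E? u) + ⟦ E? u x ⟧)
      ≡⟨ sum-distrib₃ {n} _ _ _ ⟩
    edges (avoiding? E? x) + sum (λ u → ⟦ u ≟ x ⟧ * count (E? u)) + sum (λ u → ⟦ E? u x ⟧)
      ≡⟨ cong (λ t → edges (avoiding? E? x) + t + sum (λ u → ⟦ E? u x ⟧)) (sum-δ x (count ∘ E?)) ⟩
    edges (avoiding? E? x) + count (E? x) + sum (λ u → ⟦ E? u x ⟧)
      ≡⟨ +-assoc (edges (avoiding? E? x)) _ _ ⟩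
    edges (avoiding? E? x) + (count (E? x) + sum (λ u → ⟦ E? u x ⟧))
      ≡⟨ cong (edges (avoiding? E? x) +_) (sym (∑-distrib-+ (⟦_⟧ ∘ E? x) (λ u → ⟦ E? u x ⟧))) ⟩
    edges (avoiding? E? x) + degree E? x ∎
    where
    open ≤-Reasoning
    row : ∀ u → sum (λ v → ⟦ avoiding? E? x u v ⟧ + ⟦ u ≟ x ⟧ * ⟦ E? u v ⟧ + ⟦ v ≟ x ⟧ * ⟦ E? u v ⟧)
              ≡ count (avoiding? E? x u) + ⟦ u ≟ x ⟧ * count (E? u) + ⟦ E? u x ⟧
    row u = trans (sum-distrib₃ {n} _ _ _)
      (cong₂ (λ s t → count (avoiding? E? x u) + s + t)
        (sym (*-distribˡ-sum ⟦ u ≟ x ⟧ (⟦_⟧ ∘ E? u))) (sum-δ x (⟦_⟧ ∘ E? u)))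

  Orientation-avoiding : ∀ {V E} x → Orientation V E → Orientation (V ∩ ∁ (_≡ x)) (Avoiding E x)
  Orientation-avoiding x o = record
    { adjacent   = λ (uv , _) → adjacent o uv
    ; asymmetric = λ (uv , _) (vu , _) → asymmetric o uv vu
    ; endpoints  = λ (uv , u≢x , v≢x) → (proj₁ (endpoints o uv) , u≢x) , (proj₂ (endpoints o uv) , v≢x)
    }

  edges≤count : ∀ {V E} (V? : Decidable V) (E? : Decidable₂ E) → Orientation V E → edges E? ≤ count V?
  edges≤count V? E? o = go (count V?) V? E? o ≤-refl
    where
    go : ∀ m {V E} (V? : Decidable V) (E? : Decidable₂ E) → Orientation V E → count V? ≤ m →
      edges E? ≤ count V?
    go m V? E? o fuel with any? V?
    ... | no ∄V = ≤-trans (≤-reflexive no-edges) z≤n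
      where
      no-edges : edges E? ≡ 0
      no-edges = trans (sum-cong-≗ (λ u → count-empty (E? u) (λ v uv → ∄V (u , proj₁ (endpoints o uv)))))
        (sum-replicate-zero n)
    go zero    V? E? o fuel | yes (_ , Vx) = ⊥-elim (n≮0 (≤-trans (count>0 V? Vx) fuel))
    go (suc m) {V} V? E? o fuel | yes (_ , Vx₀) with leaf E? o Vx₀
    ... | x , Vx , _ , nbrs = begin
      edges E?                                ≤⟨ edges≤edges-avoiding+degree E? x ⟩
      edges (avoiding? E? x) + degree E? x    ≤⟨ +-mono-≤ (go m V∖x? (avoiding? E? x) (Orientation-avoiding x o) fuel′)
                                                          (degree≤1 E? (asymmetric o) nbrs) ⟩
      count V∖x? + 1                          ≡⟨ +-comm (count V∖x?) 1 ⟩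
      suc (count V∖x?)                        ≤⟨ shrinks ⟩
      count V? ∎
      where
      open ≤-Reasoning
      V∖x? : Decidable (V ∩ ∁ (_≡ x))
      V∖x? = V? ∩? ∁? (_≟ x)
      shrinks : count V∖x? < count V?
      shrinks = count-mono-< V∖x? V? proj₁ Vx (λ (_ , x≢x) → x≢x refl)
      fuel′ : count V∖x? ≤ m
      fuel′ = ≤-pred (≤-trans shrinks fuel)

module Charging {n : ℕ} (D : Digraph n) (B S : Subset n) where

  open import Data.Fin.Subset using (_∈_; _∉_)
  open import Data.Bool.Properties using (T?)

  Charges : Rel (Fin n) 0ℓ
  Charges v a = (v ∈ B × v ∉ S × a ∈ S × Arc D a v) ⊎ (v ∈ B × v ∈ S × a ∈ S × a ∉ B × Adj D v a)

  charges? : Decidable₂ Charges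
  charges? v a = ((v ∈? B) ×-dec ¬? (v ∈? S) ×-dec (a ∈? S) ×-dec T? (D a v))
    ⊎-dec ((v ∈? B) ×-dec (v ∈? S) ×-dec (a ∈? S) ×-dec ¬? (a ∈? B) ×-dec (T? (D v a) ⊎-dec T? (D a v)))

  Charges-adjacent : ∀ {v a} → Charges v a → Adj D v a
  Charges-adjacent (inj₁ (_ , _ , _ , av)) = inj₂ av
  Charges-adjacent (inj₂ (_ , _ , _ , _ , va)) = va

  Charges-asymmetric : ∀ {v a} → Charges v a → ¬ Charges a v
  Charges-asymmetric (inj₁ (_ , _ , a∈S , _)) (inj₁ (_ , a∉S , _)) = a∉S a∈S
  Charges-asymmetric (inj₁ (_ , v∉S , _)) (inj₂ (_ , _ , v∈S , _)) = v∉S v∈S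
  Charges-asymmetric (inj₂ (_ , _ , _ , a∉B , _)) (inj₁ (a∈B , _)) = a∉B a∈B
  Charges-asymmetric (inj₂ (_ , _ , _ , a∉B , _)) (inj₂ (a∈B , _)) = a∉B a∈B

  B∖S? : Decidable (λ v → v ∈ B × v ∉ S)
  B∖S? = (_∈? B) ∩? ∁? (_∈? S)

  S∖B? : Decidable (λ v → v ∈ S × v ∉ B)
  S∖B? = (_∈? S) ∩? ∁? (_∈? B)

  ChargingB∩S : Pred (Fin n) 0ℓ
  ChargingB∩S v = v ∈ B × v ∈ S × ∃ (Charges v)

  chargingB∩S? : Decidable ChargingB∩S
  chargingB∩S? v = (v ∈? B) ×-dec (v ∈? S) ×-dec any? (charges? v)

  Involved : Pred (Fin n) 0ℓ
  Involved v = ((v ∈ B × v ∉ S) ⊎ (v ∈ S × v ∉ B)) ⊎ ChargingB∩S v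

  involved? : Decidable Involved
  involved? = (B∖S? ∪? S∖B?) ∪? chargingB∩S?

  ∣Involved∣≤ : count involved? ≤ count B∖S? + count S∖B? + count chargingB∩S?
  ∣Involved∣≤ = ≤-trans (count-∪ (B∖S? ∪? S∖B?) chargingB∩S?) (+-monoˡ-≤ _ (count-∪ B∖S? S∖B?))

  module _ (packing : IsTotal2LimitedPacking D B) (domination : IsTotal2Dominating D S) where

    B-neighbour-unique : ∀ {a u w} → a ∈ B → u ∈ B → Adj D u a → w ∈ B → Adj D w a → u ≡ w
    B-neighbour-unique {a} {u} {w} a∈B u∈B ua w∈B wa with u ≟ w
    ... | yes u≡w = u≡w
    ... | no u≢w  = ⊥-elim (<-irrefl refl (≤-trans (count≥2 B-adjacent? (u∈B , ua) (w∈B , wa) u≢w)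
                      (subst (_≤ 1) (length-filter-allFin B-adjacent?) (proj₁ packing a a∈B))))
      where
      B-adjacent? : Decidable (λ x → x ∈ B × Adj D x a)
      B-adjacent? x = (x ∈? B) ×-dec (T? (D x a) ⊎-dec T? (D a x))

    Charges-endpoints : ∀ {v a} → Charges v a → Involved v × Involved a
    Charges-endpoints (inj₂ (v∈B , v∈S , a∈S , a∉B , va)) =
      inj₂ (v∈B , v∈S , _ , inj₂ (v∈B , v∈S , a∈S , a∉B , va)) , inj₁ (inj₂ (a∈S , a∉B))
    Charges-endpoints {v} {a} (inj₁ (v∈B , v∉S , a∈S , av)) = inj₁ (inj₁ (v∈B , v∉S)) , a-involved
      where
      a-involved : Involved a
      a-involved with a ∈? B
      ... | no a∉B = inj₁ (inj₂ (a∈S , a∉B))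
      ... | yes a∈B with proj₁ domination a a∈S
      ...   | z , z∈S , za with z ∈? B
      ...     | no z∉B  = inj₂ (a∈B , a∈S , z , inj₂ (a∈B , a∈S , z∈S , z∉B , ⊎-swap za))
      ...     | yes z∈B = ⊥-elim (v∉S (subst (_∈ S) (sym (B-neighbour-unique a∈B v∈B (inj₂ av) z∈B za)) z∈S))

    B∖S-charges-twice : ∀ {v} → v ∈ B → v ∉ S → 2 ≤ count (charges? v)
    B∖S-charges-twice {v} v∈B v∉S = begin
      2                     ≤⟨ proj₂ domination v v∉S ⟩
      inDegIn D S v         ≡⟨ length-filter-allFin S-in-neighbour? ⟩
      count S-in-neighbour? ≤⟨ count-mono S-in-neighbour? (charges? v) (λ (u∈S , uv) → inj₁ (v∈B , v∉S , u∈S , uv)) ⟩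
      count (charges? v)    ∎
      where
      open ≤-Reasoning
      S-in-neighbour? : Decidable (λ u → u ∈ S × Arc D u v)
      S-in-neighbour? u = (u ∈? S) ×-dec T? (D u v)

    2[B∖S]+[ChargingB∩S]≤charges : ∀ v → ⟦ B∖S? v ⟧ + ⟦ B∖S? v ⟧ + ⟦ chargingB∩S? v ⟧ ≤ count (charges? v)
    2[B∖S]+[ChargingB∩S]≤charges v = ⟦⟧+⟦⟧+⟦⟧≤ (B∖S? v) (chargingB∩S? v)
      (λ (_ , v∉S) (_ , v∈S , _) → v∉S v∈S)
      (λ (v∈B , v∉S) → B∖S-charges-twice v∈B v∉S)
      (λ (_ , _ , _ , va) → count>0 (charges? v) va)

    ∣B∖S∣≤∣S∖B∣ : (∀ u → ¬ Arc D u u) → Acyclic D → count B∖S? ≤ count S∖B?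
    ∣B∖S∣≤∣S∖B∣ loopless acyclic = +-cancelˡ-≤ b b s (+-cancelʳ-≤ r (b + b) (b + s) (begin
      b + b + r         ≡⟨ sum-distrib₃ (⟦_⟧ ∘ B∖S?) (⟦_⟧ ∘ B∖S?) (⟦_⟧ ∘ chargingB∩S?) ⟨
      sum (λ v → ⟦ B∖S? v ⟧ + ⟦ B∖S? v ⟧ + ⟦ chargingB∩S? v ⟧)
                        ≤⟨ sum-mono-≤ 2[B∖S]+[ChargingB∩S]≤charges ⟩
      edges charges?    ≤⟨ edges≤count involved? charges? orientation ⟩
      count involved?   ≤⟨ ∣Involved∣≤ ⟩
      b + s + r         ∎))
      where
      open ≤-Reasoning
      open Forest D loopless acyclic using (Orientation; edges; edges≤count)
      b s r : ℕ
      b = count B∖S?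
      s = count S∖B?
      r = count chargingB∩S?
      orientation : Orientation Involved Charges
      orientation = record
        { adjacent = Charges-adjacent ; asymmetric = Charges-asymmetric ; endpoints = Charges-endpoints }

theorem4 : (n : ℕ) → 2 ≤ n → (T : Digraph n) → IsDirectedTree T →
    (B S : Subset n) → IsTotal2LimitedPacking T B → IsTotal2Dominating T S →
    ∣ B ∣ ≤ ∣ S ∣
theorem4 n _ T (loopless , _ , _ , acyclic) B S packing domination = begin
  ∣ B ∣                                              ≡⟨ ∣p∣≡count-∈ B ⟩
  count (_∈? B)                                      ≡⟨ count-split (_∈? B) (_∈? S) ⟩
  count ((_∈? B) ∩? (_∈? S)) + count B∖S?            ≤⟨ +-mono-≤ (count-mono ((_∈? B) ∩? (_∈? S)) ((_∈? S) ∩? (_∈? B)) swap)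
                                                                (∣B∖S∣≤∣S∖B∣ packing domination loopless acyclic) ⟩
  count ((_∈? S) ∩? (_∈? B)) + count S∖B?            ≡⟨ count-split (_∈? S) (_∈? B) ⟨
  count (_∈? S)                                      ≡⟨ ∣p∣≡count-∈ S ⟨
  ∣ S ∣                                              ∎
  where
  open ≤-Reasoning
  open Charging T B S
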